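{- Let $R\in\mathfrak{D}$ and $\mathfrak{D}'\subseteq\mathfrak{D}$, let $\mathcal{E}(R)$ be the EV-system of $R$ with respect to $\mathfrak{D}'$, and assume $\mathcal{E}(R)\in\mathfrak{D}'$. Then the following are equivalent: - $\alpha^R_{\mathcal{E}(R),\phi_R}$ is the identity of $\mathcal{E}_o(R)$; - for every $\mathfrak{a}\in\mathcal{E}_o(R)$ there exist $G\in\mathfrak{D}'$, $\xi\in\mathcal{S}(G,R)$ and $v\in V(G)$ with $\mathfrak{a}=\alpha^R_{G,\xi}(v)$.
   Context: Digraphs $G=(V(G),A(G))$ have a finite nonempty vertex set, and $A(G)\subseteq V(G)\times V(G)$; loops are allowed. $N^{in}_G(v)=\{w\ne v:wv\in A(G)\}$ and $N^{out}_G(v)=\{w\ne v:vw\in A(G)\}$. A homomorphism maps arcs to arcs; it is strict if, in addition, it maps proper arcs to proper arcs. $\mathcal{S}(G,H)$ is the set of strict homomorphisms. $\mathfrak{D}$ is a representative system of the isomorphism classes of finite digraphs; constructed digraphs are identified with their representatives. EV-system of $R$ with respect to $\mathfrak{D}'$: - Vertex set $\mathcal{E}_o(R)=\{(v,D,U):v\in V(R),\ D\subseteq N^{in}_R(v),\ U\subseteq N^{out}_R(v)\}$, with components $\mathfrak{a}_1,\mathfrak{a}_2,\mathfrak{a}_3$. - $\phi_R(\mathfrak{a})=\mathfrak{a}_1$, which is a strict homomorphism $\mathcal{E}(R)\to R$. - $\alpha^R_{G,\xi}(v)=(\xi(v),\xi[N^{in}_G(v)],\xi[N^{out}_G(v)])$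 for $G\in\mathfrak{D}'$ and $\xi\in\mathcal{S}(G,R)$. - $\mathfrak{a}\mathfrak{b}\in A(\mathcal{E}(R))$ iff there exist $G\in\mathfrak{D}'$, $\xi\in\mathcal{S}(G,R)$ and $vw\in A(G)$ with $\mathfrak{a}=\alpha^R_{G,\xi}(v)$ and $\mathfrak{b}=\alpha^R_{G,\xi}(w)$. -}

module Defs where

open import Data.Nat using (ℕ; suc)
open import Data.Fin using (Fin)
open import Data.Fin.Subset using (Subset; _∈_)
open import Data.Bool using (Bool; T)
open import Data.Unit using (⊤)
open import Data.Product using (Σ; ∃; ∃₂; _×_; _,_; proj₁)
open import Relation.Binary.PropositionalEquality using (_≡_; _≢_)
open import Function.Bundles using (_⇔_; _⤖_; Bijection)
open import Function.Definitions using (Injective)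

-- A finite digraph with vertex set Fin n (loops allowed): the arc relation
-- is decidable, given by a Bool-valued matrix.
FinDigraph : ℕ → Set
FinDigraph n = Fin n → Fin n → Bool

Arc : ∀ {n} → FinDigraph n → Fin n → Fin n → Set
Arc G u v = T (G u v)

IsStrictHom : {V W : Set} (A : V → V → Set) (B : W → W → Set) (ξ : V → W) → Set
IsStrictHom A B ξ = ∀ u v → A u v → B (ξ u) (ξ v) × (u ≢ v → ξ u ≢ ξ v)

IsIso : ∀ {n k} → FinDigraph n → FinDigraph k → (Fin n ⤖ Fin k) → Set
IsIso G H f = ∀ u v → Arc G u v ⇔ Arc H (Bijection.to f u) (Bijection.to f v)

IsoClosed : (∀ {n} → FinDigraph n → Set) → Set
IsoClosed D' = ∀ {n k} (G : FinDigraph n) (H : FinDigraph k) (f : Fin n ⤖ Fin k) →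
  IsIso G H f → D' G → D' H

Triple : ℕ → Set
Triple m = Fin m × Subset m × Subset m

-- (v, D, U) ∈ E_o(R): D ⊆ N^in_R(v), U ⊆ N^out_R(v)
IsEV : ∀ {m} → FinDigraph m → Triple m → Set
IsEV R (v , D , U) =
  (∀ w → w ∈ D → w ≢ v × Arc R w v) × (∀ w → w ∈ U → w ≢ v × Arc R v w)

-- Digraphs given by a vertex predicate P on a type V and an arc relation A.
-- ξ[N^in(v)] and ξ[N^out(v)] as predicates on the target vertices.
InImage : {V W : Set} (P : V → Set) (A : V → V → Set) (ξ : V → W) → V → W → Set
InImage P A ξ v w = ∃ λ u → P u × u ≢ v × A u v × ξ u ≡ w

OutImage : {V W : Set} (P : V → Set) (A : V → V → Set) (ξ : V → W) → V → W → Set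
OutImage P A ξ v w = ∃ λ u → P u × u ≢ v × A v u × ξ u ≡ w

-- α_{G,ξ}(v) = a  (set equality as extensional equality of membership)
IsAlpha : {V : Set} {m : ℕ} (P : V → Set) (A : V → V → Set) (ξ : V → Fin m) →
  V → Triple m → Set
IsAlpha P A ξ v (x , D , U) =
  ξ v ≡ x × (∀ w → w ∈ D ⇔ InImage P A ξ v w) × (∀ w → w ∈ U ⇔ OutImage P A ξ v w)

Everything : {V : Set} → V → Set
Everything _ = ⊤

EArc : (∀ {n} → FinDigraph n → Set) → ∀ {m} → FinDigraph m → Triple m → Triple m → Set
EArc D' {m} R a b =
  ∃ λ n → Σ (FinDigraph n) λ G → D' G × Σ (Fin n → Fin m) λ ξ →
    IsStrictHom (Arc G) (Arc R) ξ ×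
    ∃₂ λ v w → Arc G v w × IsAlpha Everything (Arc G) ξ v a × IsAlpha Everything (Arc G) ξ w b

φ : ∀ {m} → Triple m → Fin m
φ = proj₁

-- E(R) ∈ D' : some member of D' is isomorphic to E(R)
EInD' : (∀ {n} → FinDigraph n → Set) → ∀ {m} → FinDigraph m → Set
EInD' D' {m} R =
  ∃ λ k → Σ (FinDigraph k) λ H → D' H × Σ (Fin k → Triple m) λ f →
    (∀ i → IsEV R (f i)) × Injective _≡_ _≡_ f × (∀ a → IsEV R a → ∃ λ i → f i ≡ a) ×
    (∀ i j → Arc H i j ⇔ EArc D' R (f i) (f j))

AlphaIsId : (∀ {n} → FinDigraph n → Set) → ∀ {m} → FinDigraph m → Set
AlphaIsId D' R = ∀ a → IsEV R a → IsAlpha (IsEV R) (EArc D' R) φ a a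

Covered : (∀ {n} → FinDigraph n → Set) → ∀ {m} → FinDigraph m → Set
Covered D' {m} R = ∀ a → IsEV R a →
  ∃ λ n → Σ (FinDigraph n) λ G → D' G × Σ (Fin n → Fin m) λ ξ →
    IsStrictHom (Arc G) (Arc R) ξ × ∃ λ v → IsAlpha Everything (Arc G) ξ v a

-- The projection φ is a strict homomorphism E(R) → R, hence so is its restriction to the copy
-- H ∈ D' of E(R); if α_{E(R),φ} fixes every triple a, then a = α_{H,φ}(a) is covered.
-- Conversely, let a = α_{G,ξ}(v). Each w in the in-part of a is ξ(u) for an arc uv of G, and
-- α_{G,ξ}(u) is then an E(R)-in-neighbour of a with φ-image w. Every E(R)-arc ba comes from an
-- arc v′w′ of some G with b = α(v′), a = α(w′); since b ≠ a and α is a function, v′ ≠ w′, so φ(b)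
-- lies in the in-part of a. Hence α_{E(R),φ}(a) = a, the out-parts being symmetric.

module Submission where

open import Defs
open import Data.Nat using (ℕ; suc)
open import Data.Bool using (Bool; true; T)
open import Data.Bool.Properties using (T-≡)
open import Data.Fin using (Fin; _≟_)
open import Data.Fin.Properties using (any?)
open import Data.Fin.Subset using (Subset; _∈_)
open import Data.Fin.Subset.Properties using (⊆-antisym)
open import Data.Product using (Σ; ∃; _×_; _,_; proj₁; proj₂)
open import Data.Unit using (tt)
open import Data.Vec using (lookup; tabulate)
open import Data.Vec.Properties using ([]=↔lookup; lookup∘tabulate)
open import Function using (_∘_; flip)
open import Function.Bundles using (_⇔_; mk⇔; module Equivalence)
open import Function.Definitions using (Injective)
import Function.Properties.Equivalence as ⇔
open import Function.Properties.Inverse using (↔⇒⇔)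
open import Relation.Binary.PropositionalEquality
  using (_≡_; _≢_; refl; sym; trans; cong; cong₂; subst₂; ≢-sym)
import Relation.Binary.Reasoning.Setoid as SetoidReasoning
open import Relation.Nullary.Decidable using (isYes; yes; ¬?; _×-dec_; toWitness; fromWitness; T?)
open import Relation.Unary using (Decidable)

open Equivalence using (to; from)

Subset-ext : ∀ {m} {S S′ : Subset m} → (∀ w → w ∈ S ⇔ w ∈ S′) → S ≡ S′
Subset-ext S⇔S′ = ⊆-antisym (λ {w} → to (S⇔S′ w)) (λ {w} → from (S⇔S′ w))

∈-tabulate : ∀ {m} (f : Fin m → Bool) w → w ∈ tabulate f ⇔ T (f w)
∈-tabulate f w = begin
  w ∈ tabulate f               ≈⟨ ↔⇒⇔ []=↔lookup ⟩
  lookup (tabulate f) w ≡ true ≡⟨ cong (_≡ true) (lookup∘tabulate f w) ⟩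
  f w ≡ true                   ≈⟨ ⇔.sym T-≡ ⟩
  T (f w)                      ∎
  where open SetoidReasoning (⇔.⇔-setoid _)

decidable⇒Subset : ∀ {m} {Q : Fin m → Set} → Decidable Q → Σ (Subset m) λ S → ∀ w → w ∈ S ⇔ Q w
decidable⇒Subset Q? = tabulate (isYes ∘ Q?) , λ w →
  ⇔.trans (∈-tabulate _ w) (mk⇔ (toWitness {a? = Q? w}) fromWitness)

module _ {V : Set} {m : ℕ} {P : V → Set} {A : V → V → Set} {ξ : V → Fin m} where

  IsAlpha-functional : ∀ {v a b} → IsAlpha P A ξ v a → IsAlpha P A ξ v b → a ≡ b
  IsAlpha-functional {a = _ , D , U} {b = _ , D′ , U′} (refl , D⇔ , U⇔) (refl , D′⇔ , U′⇔) =
    cong₂ (λ D U → _ , D , U)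
      (Subset-ext λ w → ⇔.trans (D⇔ w) (⇔.sym (D′⇔ w)))
      (Subset-ext λ w → ⇔.trans (U⇔ w) (⇔.sym (U′⇔ w)))

  IsAlpha-≢ : ∀ {v w a b} → IsAlpha P A ξ v a → IsAlpha P A ξ w b → a ≢ b → v ≢ w
  IsAlpha-≢ αa αb a≢b refl = a≢b (IsAlpha-functional αa αb)

module _ {V W : Set} {A : V → V → Set} {B : W → W → Set} {ξ : V → W}
         (ξ-hom : IsStrictHom A B ξ) where

  InImage-strictHom : ∀ {P : V → Set} {v w} → InImage P A ξ v w → w ≢ ξ v × B w (ξ v)
  InImage-strictHom {v = v} (u , _ , u≢v , uv , refl) = proj₂ (ξ-hom u v uv) u≢v , proj₁ (ξ-hom u v uv)

  OutImage-strictHom : ∀ {P : V → Set} {v w} → OutImage P A ξ v w → w ≢ ξ v × B (ξ v) w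
  OutImage-strictHom {v = v} (u , _ , u≢v , vu , refl) =
    ≢-sym (proj₂ (ξ-hom v u vu) (≢-sym u≢v)) , proj₁ (ξ-hom v u vu)

IsAlpha⇒IsEV : ∀ {V m} {P : V → Set} {A : V → V → Set} {R : FinDigraph m} {ξ : V → Fin m} {v a} →
  IsStrictHom A (Arc R) ξ → IsAlpha P A ξ v a → IsEV R a
IsAlpha⇒IsEV {R = R} {a = _ , _ , _} ξ-hom (refl , D⇔ , U⇔) =
  (λ w w∈D → InImage-strictHom {B = Arc R} ξ-hom (to (D⇔ w) w∈D)) ,
  (λ w w∈U → OutImage-strictHom {B = Arc R} ξ-hom (to (U⇔ w) w∈U))

alpha : ∀ {n m} (G : FinDigraph n) (ξ : Fin n → Fin m) v → Σ (Triple m) (IsAlpha Everything (Arc G) ξ v)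
alpha G ξ v = (ξ v , proj₁ ins , proj₁ outs) , refl , proj₂ ins , proj₂ outs
  where
  ins : Σ (Subset _) λ S → ∀ w → w ∈ S ⇔ InImage Everything (Arc G) ξ v w
  ins = decidable⇒Subset λ w → any? λ u → yes tt ×-dec ¬? (u ≟ v) ×-dec T? (G u v) ×-dec ξ u ≟ w
  outs : Σ (Subset _) λ S → ∀ w → w ∈ S ⇔ OutImage Everything (Arc G) ξ v w
  outs = decidable⇒Subset λ w → any? λ u → yes tt ×-dec ¬? (u ≟ v) ×-dec T? (G v u) ×-dec ξ u ≟ w

record IsIsoOnto {V W : Set} (P : W → Set) (A : V → V → Set) (B : W → W → Set) (f : V → W) : Set where
  field
    lands     : ∀ i → P (f i)
    injective : Injective _≡_ _≡_ f
    onto      : ∀ b → P b → ∃ λ i → f i ≡ b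
    arc       : ∀ i j → A i j ⇔ B (f i) (f j)

module _ {V W : Set} {P : W → Set} {f : V → W} where

  IsIsoOnto-flip : ∀ {A B} → IsIsoOnto P A B f → IsIsoOnto P (flip A) (flip B) f
  IsIsoOnto-flip iso = record { IsIsoOnto iso; arc = λ i j → IsIsoOnto.arc iso j i }

  IsIsoOnto-strictHom : ∀ {U : Set} {A B} {C : U → U → Set} {g : W → U} →
    IsIsoOnto P A B f → IsStrictHom B C g → IsStrictHom A C (g ∘ f)
  IsIsoOnto-strictHom iso g-hom i j ij =
    proj₁ (g-hom (f i) (f j) (to (arc i j) ij)) ,
    λ i≢j → proj₂ (g-hom (f i) (f j) (to (arc i j) ij)) (i≢j ∘ injective)
    where open IsIsoOnto iso

  InImage-IsIsoOnto : ∀ {A B m} (ψ : W → Fin m) → IsIsoOnto P A B f →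
    ∀ i w → InImage Everything A (ψ ∘ f) i w ⇔ InImage P B ψ (f i) w
  InImage-IsIsoOnto {A} {B} ψ iso i w = mk⇔
    (λ { (j , _ , j≢i , ji , ψfj≡w) → f j , lands j , j≢i ∘ injective , to (arc j i) ji , ψfj≡w })
    pull
    where
    open IsIsoOnto iso
    pull : InImage P B ψ (f i) w → InImage Everything A (ψ ∘ f) i w
    pull (b , Pb , b≢fi , bfi , ψb≡w) with onto b Pb
    ... | j , refl = j , tt , (λ j≡i → b≢fi (cong f j≡i)) , from (arc j i) bfi , ψb≡w

  IsAlpha-IsIsoOnto : ∀ {A B m} {ψ : W → Fin m} {i a} → IsIsoOnto P A B f →
    IsAlpha P B ψ (f i) a → IsAlpha Everything A (ψ ∘ f) i a
  IsAlpha-IsIsoOnto {ψ = ψ} {i} {_ , _ , _} iso (refl , D⇔ , U⇔) =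
    refl ,
    (λ w → ⇔.trans (D⇔ w) (⇔.sym (InImage-IsIsoOnto ψ iso i w))) ,
    -- OutImage P B is definitionally InImage P (flip B).
    (λ w → ⇔.trans (U⇔ w) (⇔.sym (InImage-IsIsoOnto ψ (IsIsoOnto-flip iso) i w)))

module EVSystem (D' : ∀ {n} → FinDigraph n → Set) {m} (R : FinDigraph m) where

  IsRealised : Triple m → Set
  IsRealised a = ∃ λ n → Σ (FinDigraph n) λ G → D' G × Σ (Fin n → Fin m) λ ξ →
    IsStrictHom (Arc G) (Arc R) ξ × ∃ λ v → IsAlpha Everything (Arc G) ξ v a

  φ-strictHom : IsStrictHom (EArc D' R) (Arc R) φ
  φ-strictHom a b (_ , G , _ , ξ , ξ-hom , v , w , vw , αa , αb) =
    subst₂ (Arc R) (proj₁ αa) (proj₁ αb) (proj₁ (ξ-hom v w vw)) ,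
    λ a≢b φa≡φb → proj₂ (ξ-hom v w vw) (IsAlpha-≢ αa αb a≢b)
      (trans (proj₁ αa) (trans φa≡φb (sym (proj₁ αb))))

  InImage-EArc⇒∈ : ∀ {a w} → InImage (IsEV R) (EArc D' R) φ a w → w ∈ proj₁ (proj₂ a)
  InImage-EArc⇒∈ (b , _ , b≢a , (_ , G , _ , ξ , _ , u , v , uv , αb , αa@(_ , D⇔ , _)) , refl) =
    from (D⇔ _) (u , tt , IsAlpha-≢ αb αa b≢a , uv , proj₁ αb)

  OutImage-EArc⇒∈ : ∀ {a w} → OutImage (IsEV R) (EArc D' R) φ a w → w ∈ proj₂ (proj₂ a)
  OutImage-EArc⇒∈ (b , _ , b≢a , (_ , G , _ , ξ , _ , v , u , vu , αa@(_ , _ , U⇔) , αb) , refl) =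
    from (U⇔ _) (u , tt , IsAlpha-≢ αb αa b≢a , vu , proj₁ αb)

  ∈⇒InImage-EArc : ∀ {a w} → IsEV R a → IsRealised a → w ∈ proj₁ (proj₂ a) →
    InImage (IsEV R) (EArc D' R) φ a w
  ∈⇒InImage-EArc {a} (inD , _) (n , G , G∈D' , ξ , ξ-hom , v , αa@(_ , D⇔ , _)) w∈D
    with to (D⇔ _) w∈D
  ... | u , _ , _ , uv , refl =
    b , IsAlpha⇒IsEV {R = R} ξ-hom αb , b≢a , (n , G , G∈D' , ξ , ξ-hom , u , v , uv , αb , αa) , proj₁ αb
    where
    b : Triple m
    b = proj₁ (alpha G ξ u)
    αb : IsAlpha Everything (Arc G) ξ u b
    αb = proj₂ (alpha G ξ u)
    b≢a : b ≢ a
    b≢a b≡a = proj₁ (inD (ξ u) w∈D) (trans (sym (proj₁ αb)) (cong φ b≡a))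

  ∈⇒OutImage-EArc : ∀ {a w} → IsEV R a → IsRealised a → w ∈ proj₂ (proj₂ a) →
    OutImage (IsEV R) (EArc D' R) φ a w
  ∈⇒OutImage-EArc {a} (_ , inU) (n , G , G∈D' , ξ , ξ-hom , v , αa@(_ , _ , U⇔)) w∈U
    with to (U⇔ _) w∈U
  ... | u , _ , _ , vu , refl =
    b , IsAlpha⇒IsEV {R = R} ξ-hom αb , b≢a , (n , G , G∈D' , ξ , ξ-hom , v , u , vu , αa , αb) , proj₁ αb
    where
    b : Triple m
    b = proj₁ (alpha G ξ u)
    αb : IsAlpha Everything (Arc G) ξ u b
    αb = proj₂ (alpha G ξ u)
    b≢a : b ≢ a
    b≢a b≡a = proj₁ (inU (ξ u) w∈U) (trans (sym (proj₁ αb)) (cong φ b≡a))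

  Covered⇒AlphaIsId : Covered D' R → AlphaIsId D' R
  Covered⇒AlphaIsId covered a a∈E =
    refl ,
    (λ w → mk⇔ (∈⇒InImage-EArc a∈E (covered a a∈E)) InImage-EArc⇒∈) ,
    (λ w → mk⇔ (∈⇒OutImage-EArc a∈E (covered a a∈E)) OutImage-EArc⇒∈)

  AlphaIsId⇒Covered : EInD' D' R → AlphaIsId D' R → Covered D' R
  AlphaIsId⇒Covered (k , H , H∈D' , f , f-EV , f-inj , f-onto , f-arc) alphaIsId a a∈E
    with f-onto a a∈E
  ... | i , refl =
    k , H , H∈D' , φ ∘ f , IsIsoOnto-strictHom iso φ-strictHom ,
    i , IsAlpha-IsIsoOnto iso (alphaIsId (f i) (f-EV i))
    where
    iso : IsIsoOnto (IsEV R) (Arc H) (EArc D' R) f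
    iso = record { lands = f-EV ; injective = f-inj ; onto = f-onto ; arc = f-arc }

lemma3 : ∀ {m} (R : FinDigraph (suc m)) (D' : ∀ {n} → FinDigraph n → Set) →
    IsoClosed D' → EInD' D' R → (AlphaIsId D' R ⇔ Covered D' R)
lemma3 R D' _ E∈D' = mk⇔ (AlphaIsId⇒Covered E∈D') Covered⇒AlphaIsId
  where open EVSystem D' R
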